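{- Let $m\ge 4$ be even, $n=2^m-1$, and let $i_1,i_2\in\{0,1,2,3\}$ with $i_1-i_2\equiv 1\pmod 2$. Then the extended code $(\mathcal{C}_{i_1,i_2})^*$ equals the code $(\mathcal{C}^*)_{i_1+1,i_2+1}$ (indices taken modulo $4$) if and only if $0\notin\{i_1,i_2\}$.
   Context: $\mathbb{F}_2$ is the binary field. Let $\alpha$ be a primitive element of $GF(2^m)$ and let $H_m$ be the $m\times n$ binary matrix whose $i$-th column $\mathbf{h}_i$ ($i=0,\dots,n-1$) is the coordinate vector of $\alpha^i$ with respect to the basis $1,\alpha,\dots,\alpha^{m-1}$ (so the columns are exactly the nonzero vectors of $\mathbb{F}_2^m$; $H_m$ is a parity check matrix of the Hamming code). For distinct $i_1,i_2\in\{0,1,2,3\}$, $\mathbf{v}_{i_1,i_2}=(v_0,\dots,v_{n-1})$ has $v_i=1$ iff the Hamming weight $\mathrm{wt}(\mathbf{h}_i)\equiv i_1$ or $i_2\pmod 4$; $\mathcal{C}_{i_1,i_2}$ is the code with parity check matrix $H_m$ with the row $\mathbf{v}_{i_1,i_2}$ appended. For a code $C$ of length $n$, its extension $C^*$ is the length-$(n+1)$ code $\{(c_{\infty},c_0,\dots,c_{n-1}): (c_0,\dots,c_{n-1})\in C,\ c_\infty=\sum_i c_i\}$ (parity check position first). Let $H_m^*$ be the $(m+1)\times(n+1)$ matrix obtained from $H_m$ by prepending a zero column (at the parity check position) and then appending the all-one row; it is a parity check matrix of the extended Hamming code. For distinct $j_1,j_2\in\{0,1,2,3\}$, let $\mathbf{v}^*_{j_1,j_2}$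 be the length-$(n+1)$ vector whose entry at each position is $1$ iff the Hamming weight of the corresponding column of $H_m^*$ is $\equiv j_1$ or $j_2\pmod 4$, and let $(\mathcal{C}^*)_{j_1,j_2}$ denote the code with parity check matrix $H^*_m$ with the row $\mathbf{v}^*_{j_1,j_2}$ appended. -}

module Defs where

open import Data.Bool using (Bool; true; false; _∧_; _xor_; if_then_else_)
open import Data.Nat using (ℕ; zero; suc; _+_; _%_; _≡ᵇ_; _∸_; _^_)
open import Data.Fin using (Fin; zero; suc)
open import Data.Vec using (Vec; lookup; replicate)
open import Data.Product using (_×_; Σ)
open import Function using (_∘_)
open import Relation.Binary.PropositionalEquality using (_≡_)
open import Relation.Nullary using (¬_)

-- binary words / matrices over F₂ (F₂ = Bool, addition = xor, product = ∧)
Word : ℕ → Set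
Word n = Fin n → Bool

Mat : ℕ → ℕ → Set
Mat r c = Fin r → Fin c → Bool

bsum : ∀ {n} → Word n → Bool
bsum {zero}  w = false
bsum {suc n} w = w zero xor bsum (w ∘ suc)

wt : ∀ {n} → Word n → ℕ
wt {zero}  w = 0
wt {suc n} w = (if w zero then 1 else 0) + wt (w ∘ suc)

Code : ℕ → Set₁
Code n = Word n → Set

codeOf : ∀ {r c} → Mat r c → Code c
codeOf M w = ∀ i → bsum (λ j → M i j ∧ w j) ≡ false

_≐_ : ∀ {n} → Code n → Code n → Set
A ≐ B = ∀ w → (A w → B w) × (B w → A w)

appendRow : ∀ {r c} → Mat r c → Word c → Mat (suc r) c
appendRow {zero}  M v zero    = v
appendRow {suc r} M v zero    = M zero
appendRow {suc r} M v (suc i) = appendRow (M ∘ suc) v i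

-- prepend a zero column (the parity check position ∞ = index zero)
prependZeroCol : ∀ {r c} → Mat r c → Mat r (suc c)
prependZeroCol M i zero    = false
prependZeroCol M i (suc j) = M i j

allOne : ∀ {c} → Word c
allOne _ = true

column : ∀ {r c} → Mat r c → Fin c → Word r
column M j i = M i j

weightRow : ∀ {r c} → Mat r c → ℕ → ℕ → Word c
weightRow M j₁ j₂ j =
  let w = wt (column M j) % 4 in (w ≡ᵇ j₁) Data.Bool.∨ (w ≡ᵇ j₂)

-- the extension C* of a code C (parity check position first = index zero)
extend : ∀ {n} → Code n → Code (suc n)
extend C w = C (w ∘ suc) × (w zero ≡ bsum (w ∘ suc))

Hmat : ∀ {m n} → (Fin n → Vec Bool m) → Mat m n
Hmat h i j = lookup (h j) i

Cij : ∀ {m n} → (Fin n → Vec Bool m) → ℕ → ℕ → Code n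
Cij h i₁ i₂ = codeOf (appendRow (Hmat h) (weightRow (Hmat h) i₁ i₂))

Hstar : ∀ {m n} → (Fin n → Vec Bool m) → Mat (suc m) (suc n)
Hstar h = appendRow (prependZeroCol (Hmat h)) allOne

CstarJ : ∀ {m n} → (Fin n → Vec Bool m) → ℕ → ℕ → Code (suc n)
CstarJ h j₁ j₂ = codeOf (appendRow (Hstar h) (weightRow (Hstar h) j₁ j₂))

IsHammingEnum : ∀ {m n} → (Fin n → Vec Bool m) → Set
IsHammingEnum {m} {n} h =
    (∀ i → ¬ (h i ≡ replicate m false))
  × (∀ i j → h i ≡ h j → i ≡ j)
  × (∀ (x : Vec Bool m) → ¬ (x ≡ replicate m false) → Σ (Fin n) (λ i → h i ≡ x))

module Submission where

-- Write v = v_{i₁,i₂} and v* = v*_{i₁+1,i₂+1}.  A column of H*_m other than the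
-- parity column is a column h_j of H_m with a 1 appended, of weight wt(h_j)+1;
-- shifting both the weight and the residues i₁, i₂ by one, v* agrees with v
-- off the parity position.  The parity column of H*_m is (0,…,0,1), of weight
-- 1, so v*_∞ = 1 iff 0 ∈ {i₁, i₂}.  The theorem thus reduces to a criterion
-- valid for any parity check matrix M and any row v* = (b, v): the extension
-- of code(M; v) equals code(M*; v*) iff b = 0, provided code(M) contains a
-- word c of odd weight (if b = 1 the word (1, c) lies in exactly one of the
-- two codes).  The Hamming code has such a word as soon as m ≥ 2: the sum of
-- the unit words at the positions of the columns e₁, e₂ and e₁ + e₂.

open import Defs
open import Data.Bool using (Bool)
open import Data.Nat using (ℕ; _≤_; _<_; _+_; _%_; _∸_; _^_)
open import Data.Fin using (Fin)
open import Data.Vec using (Vec)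
open import Data.Product using (_×_)
open import Function.Bundles using (_⇔_)
open import Relation.Binary.PropositionalEquality using (_≡_; _≢_)
open import Relation.Nullary using (¬_)

open import Data.Bool using (true; false; not; _∧_; _∨_; _xor_; if_then_else_)
open import Data.Bool.Properties
  using (xor-∧-commutativeRing; xor-same; xor-identityʳ; ∧-identityʳ; ∧-zeroʳ;
         ∧-distribˡ-xor; ∨-conicalˡ; ∨-conicalʳ)
open import Algebra.Bundles using (CommutativeRing)
open import Algebra.Properties.CommutativeSemigroup
  (CommutativeRing.+-commutativeSemigroup xor-∧-commutativeRing)
  using () renaming (interchange to xor-interchange)
open import Data.Nat using (zero; suc; NonZero; _≡ᵇ_)
open import Data.Nat.Properties using (_≟_; +-identityʳ; +-assoc)
open import Data.Nat.DivMod using (%-distribˡ-+; [m+n]%n≡m%n; m<n⇒m%n≡m)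
open import Data.Fin using (zero; suc)
open import Data.Vec using (_∷_; lookup; replicate; zipWith)
open import Data.Vec.Properties using (lookup-zipWith)
open import Data.Product using (_,_; proj₁; proj₂; Σ)
open import Data.Product.Function.NonDependent.Propositional using (_×-⇔_)
open import Data.Empty using (⊥-elim)
open import Function using (_∘_)
open import Function.Bundles using (mk⇔; Equivalence)
open import Function.Properties.Equivalence using () renaming (refl to ⇔-refl; sym to ⇔-sym; trans to ⇔-trans)
open import Relation.Binary.PropositionalEquality using (refl; sym; trans; cong; cong₂; module ≡-Reasoning)
open import Relation.Nullary.Decidable using (does-⇔)

open Equivalence using (to; from)
open ≡-Reasoning

bsum-cong : ∀ {n} {u u′ : Word n} → (∀ j → u j ≡ u′ j) → bsum u ≡ bsum u′
bsum-cong {zero}  p = refl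
bsum-cong {suc n} p = cong₂ _xor_ (p zero) (bsum-cong (p ∘ suc))

bsum-false : ∀ {n} → bsum {n} (λ _ → false) ≡ false
bsum-false {zero}  = refl
bsum-false {suc n} = bsum-false {n}

bsum-xor : ∀ {n} (u u′ : Word n) → bsum (λ j → u j xor u′ j) ≡ bsum u xor bsum u′
bsum-xor {zero}  u u′ = refl
bsum-xor {suc n} u u′ = begin
  (u zero xor u′ zero) xor bsum (λ j → u (suc j) xor u′ (suc j))
    ≡⟨ cong ((u zero xor u′ zero) xor_) (bsum-xor (u ∘ suc) (u′ ∘ suc)) ⟩
  (u zero xor u′ zero) xor (bsum (u ∘ suc) xor bsum (u′ ∘ suc))
    ≡⟨ xor-interchange (u zero) (u′ zero) _ _ ⟩
  bsum u xor bsum u′ ∎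

inner-xor : ∀ {n} (f x y : Word n) →
  bsum (λ j → f j ∧ (x j xor y j)) ≡ bsum (λ j → f j ∧ x j) xor bsum (λ j → f j ∧ y j)
inner-xor f x y =
  trans (bsum-cong (λ j → ∧-distribˡ-xor (f j) (x j) (y j))) (bsum-xor (λ j → f j ∧ x j) (λ j → f j ∧ y j))

unit : ∀ {n} → Fin n → Word n
unit zero    zero    = true
unit zero    (suc _) = false
unit (suc a) zero    = false
unit (suc a) (suc j) = unit a j

inner-unit : ∀ {n} (f : Word n) (a : Fin n) → bsum (λ j → f j ∧ unit a j) ≡ f a
inner-unit {suc n} f zero = begin
  (f zero ∧ true) xor bsum (λ j → f (suc j) ∧ false)
    ≡⟨ cong₂ _xor_ (∧-identityʳ (f zero))
                   (trans (bsum-cong (λ j → ∧-zeroʳ (f (suc j)))) (bsum-false {n})) ⟩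
  f zero xor false ≡⟨ xor-identityʳ (f zero) ⟩
  f zero ∎
inner-unit {suc n} f (suc a) =
  trans (cong (_xor bsum (λ j → f (suc j) ∧ unit a j)) (∧-zeroʳ (f zero)))
        (inner-unit (f ∘ suc) a)

triple : ∀ {n} → Fin n → Fin n → Fin n → Word n
triple a b c j = (unit a j xor unit b j) xor unit c j

inner-triple : ∀ {n} (f : Word n) (a b c : Fin n) →
  bsum (λ j → f j ∧ triple a b c j) ≡ (f a xor f b) xor f c
inner-triple f a b c = begin
  bsum (λ j → f j ∧ triple a b c j)
    ≡⟨ inner-xor f _ (unit c) ⟩
  bsum (λ j → f j ∧ (unit a j xor unit b j)) xor bsum (λ j → f j ∧ unit c j)
    ≡⟨ cong₂ _xor_ (inner-xor f (unit a) (unit b)) (inner-unit f c) ⟩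
  (bsum (λ j → f j ∧ unit a j) xor bsum (λ j → f j ∧ unit b j)) xor f c
    ≡⟨ cong (_xor f c) (cong₂ _xor_ (inner-unit f a) (inner-unit f b)) ⟩
  (f a xor f b) xor f c ∎

-- e_a + e_b + e_c has odd weight, even if a, b, c are not distinct.
triple-odd : ∀ {n} (a b c : Fin n) → bsum (triple a b c) ≡ true
triple-odd a b c = inner-triple (λ _ → true) a b c

xor-false⇔≡ : ∀ x y → (x xor y ≡ false) ⇔ (x ≡ y)
xor-false⇔≡ false false = mk⇔ (λ _ → refl) (λ _ → refl)
xor-false⇔≡ false true  = mk⇔ (λ ()) (λ ())
xor-false⇔≡ true  false = mk⇔ (λ ()) (λ ())
xor-false⇔≡ true  true  = mk⇔ (λ _ → refl) (λ _ → refl)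

≡false-cong : ∀ {x y} → x ≡ y → (x ≡ false) ⇔ (y ≡ false)
≡false-cong x≡y = mk⇔ (trans (sym x≡y)) (trans x≡y)

not-self-dual : ∀ b → ¬ ((b ≡ false) ⇔ (not b ≡ false))
not-self-dual false b⇔not-b with to b⇔not-b refl
... | ()
not-self-dual true  b⇔not-b with from b⇔not-b refl
... | ()

∨-false⇔ : ∀ x y → (x ∨ y ≡ false) ⇔ (x ≡ false × y ≡ false)
∨-false⇔ x y = mk⇔ (λ e → ∨-conicalˡ x y e , ∨-conicalʳ x y e)
                   (λ { (refl , refl) → refl })

zero-test⇔ : ∀ i → ((0 ≡ᵇ i) ≡ false) ⇔ (i ≢ 0)
zero-test⇔ zero    = mk⇔ (λ ()) (λ i≢0 → ⊥-elim (i≢0 refl))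
zero-test⇔ (suc i) = mk⇔ (λ _ ()) (λ _ → refl)

appendRow-code : ∀ {r c} (M : Mat r c) (v w : Word c) →
  codeOf (appendRow M v) w ⇔ (codeOf M w × bsum (λ j → v j ∧ w j) ≡ false)
appendRow-code M v w = mk⇔ (split M) (join M)
  where
  split : ∀ {r} (M : Mat r _) → codeOf (appendRow M v) w →
          codeOf M w × bsum (λ j → v j ∧ w j) ≡ false
  split {zero}  M p = (λ ()) , p zero
  split {suc r} M p with split (M ∘ suc) (p ∘ suc)
  ... | rest , check = (λ { zero → p zero ; (suc i) → rest i }) , check
  join : ∀ {r} (M : Mat r _) → codeOf M w × bsum (λ j → v j ∧ w j) ≡ false →
         codeOf (appendRow M v) w
  join {zero}  M (_ , check) zero    = check
  join {suc r} M (p , _)     zero    = p zero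
  join {suc r} M (p , check) (suc i) = join (M ∘ suc) (p ∘ suc , check) i

extendedMatrix-code : ∀ {r c} (M : Mat r c) (w : Word (suc c)) →
  codeOf (appendRow (prependZeroCol M) allOne) w ⇔
    (codeOf M (w ∘ suc) × w zero ≡ bsum (w ∘ suc))
extendedMatrix-code M w =
  ⇔-trans (appendRow-code (prependZeroCol M) allOne w)
          (⇔-refl ×-⇔ xor-false⇔≡ (w zero) (bsum (w ∘ suc)))

extendedCode : ∀ {r c} → Mat r c → Word c → Code (suc c)
extendedCode M v = extend (codeOf (appendRow M v))

liftedCode : ∀ {r c} → Mat r c → Word (suc c) → Code (suc c)
liftedCode M v* = codeOf (appendRow (appendRow (prependZeroCol M) allOne) v*)

OddCodeword : ∀ {r c} → Mat r c → Set
OddCodeword {c = c} M = Σ (Word c) (λ x → codeOf M x × bsum x ≡ true)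

module ExtensionCriterion {r c} (M : Mat r c) (v : Word c) (v* : Word (suc c))
                          (v*-lifts-v : ∀ j → v* (suc j) ≡ v j) where

  oldCheck : Word (suc c) → Bool
  oldCheck w = bsum (λ j → v j ∧ w (suc j))

  extendedCode-⇔ : ∀ w → extendedCode M v w ⇔
    ((codeOf M (w ∘ suc) × w zero ≡ bsum (w ∘ suc)) × oldCheck w ≡ false)
  extendedCode-⇔ w =
    ⇔-trans (appendRow-code M v (w ∘ suc) ×-⇔ ⇔-refl)
            (mk⇔ (λ { ((p , check) , parity) → (p , parity) , check })
                 (λ { ((p , parity) , check) → (p , check) , parity }))

  liftedCheck : ∀ w → bsum (λ j → v* j ∧ w j) ≡ (v* zero ∧ w zero) xor oldCheck w
  liftedCheck w =
    cong ((v* zero ∧ w zero) xor_)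
         (bsum-cong (λ j → cong (_∧ w (suc j)) (v*-lifts-v j)))

  liftedCode-⇔ : ∀ w → liftedCode M v* w ⇔
    ((codeOf M (w ∘ suc) × w zero ≡ bsum (w ∘ suc)) ×
     (v* zero ∧ w zero) xor oldCheck w ≡ false)
  liftedCode-⇔ w =
    ⇔-trans (appendRow-code _ v* w)
            (extendedMatrix-code M w ×-⇔ ≡false-cong (liftedCheck w))

  agrees : v* zero ≡ false → extendedCode M v ≐ liftedCode M v*
  agrees v*₀≡0 w = to same , from same
    where
    sameCheck : (v* zero ∧ w zero) xor oldCheck w ≡ oldCheck w
    sameCheck = cong (λ t → (t ∧ w zero) xor oldCheck w) v*₀≡0
    same : extendedCode M v w ⇔ liftedCode M v* w
    same = ⇔-trans (extendedCode-⇔ w)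
           (⇔-trans (⇔-refl ×-⇔ ≡false-cong (sym sameCheck)) (⇔-sym (liftedCode-⇔ w)))

  -- If v*_∞ = 1, then (1, x) for an odd codeword x of M lies in exactly one of
  -- the two codes: their new checks on it are ⟨v, x⟩ and 1 + ⟨v, x⟩.
  differs : v* zero ≡ true → OddCodeword M → ¬ (extendedCode M v ≐ liftedCode M v*)
  differs v*₀≡1 (x , x∈M , x-odd) same =
    not-self-dual (oldCheck w) (mk⇔ inLifted inExtended)
    where
    w : Word (suc c)
    w zero    = true
    w (suc j) = x j
    base : codeOf M x × true ≡ bsum x
    base = x∈M , sym x-odd
    newCheck : (v* zero ∧ true) xor oldCheck w ≡ not (oldCheck w)
    newCheck = cong (λ t → (t ∧ true) xor oldCheck w) v*₀≡1
    inLifted : oldCheck w ≡ false → not (oldCheck w) ≡ false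
    inLifted check =
      let l = proj₁ (same w) (from (extendedCode-⇔ w) (base , check))
      in trans (sym newCheck) (proj₂ (to (liftedCode-⇔ w) l))
    inExtended : not (oldCheck w) ≡ false → oldCheck w ≡ false
    inExtended check =
      let e = proj₂ (same w) (from (liftedCode-⇔ w) (base , trans newCheck check))
      in proj₂ (to (extendedCode-⇔ w) e)

  criterion : OddCodeword M → (extendedCode M v ≐ liftedCode M v*) ⇔ (v* zero ≡ false)
  criterion odd = mk⇔ headBit agrees
    where
    headBit : extendedCode M v ≐ liftedCode M v* → v* zero ≡ false
    headBit same with v* zero in v*₀
    ... | false = refl
    ... | true  = ⊥-elim (differs v*₀ odd same)

dependent-triple : ∀ {r c} (M : Mat r c) (a b d : Fin c) →
  (∀ i → M i d ≡ M i a xor M i b) → codeOf M (triple a b d)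
dependent-triple M a b d dep i = begin
  bsum (λ j → M i j ∧ triple a b d j)      ≡⟨ inner-triple (M i) a b d ⟩
  (M i a xor M i b) xor M i d              ≡⟨ cong ((M i a xor M i b) xor_) (dep i) ⟩
  (M i a xor M i b) xor (M i a xor M i b)  ≡⟨ xor-same (M i a xor M i b) ⟩
  false                                    ∎

hamming-oddCodeword : ∀ {k n} (h : Fin n → Vec Bool (suc (suc k))) →
  IsHammingEnum h → OddCodeword (Hmat h)
hamming-oddCodeword {k} h (_ , _ , onto) =
  triple a b d , dependent-triple (Hmat h) a b d dep , triple-odd a b d
  where
  e₁ e₂ : Vec Bool (suc (suc k))
  e₁ = true ∷ false ∷ replicate k false
  e₂ = false ∷ true ∷ replicate k false
  a-col : Σ (Fin _) (λ i → h i ≡ e₁)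
  a-col = onto e₁ (λ ())
  b-col : Σ (Fin _) (λ i → h i ≡ e₂)
  b-col = onto e₂ (λ ())
  d-col : Σ (Fin _) (λ i → h i ≡ zipWith _xor_ e₁ e₂)
  d-col = onto (zipWith _xor_ e₁ e₂) (λ ())
  a b d : Fin _
  a = proj₁ a-col
  b = proj₁ b-col
  d = proj₁ d-col
  dep : ∀ i → lookup (h d) i ≡ lookup (h a) i xor lookup (h b) i
  dep i = begin
    lookup (h d) i                      ≡⟨ cong (λ x → lookup x i) (proj₂ d-col) ⟩
    lookup (zipWith _xor_ e₁ e₂) i      ≡⟨ lookup-zipWith _xor_ i e₁ e₂ ⟩
    lookup e₁ i xor lookup e₂ i         ≡⟨ sym (cong₂ (λ x y → lookup x i xor lookup y i)
                                                      (proj₂ a-col) (proj₂ b-col)) ⟩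
    lookup (h a) i xor lookup (h b) i   ∎

wt-appendRow : ∀ {r c} (M : Mat r c) (v : Word c) (j : Fin c) →
  wt (column (appendRow M v) j) ≡ wt (column M j) + (if v j then 1 else 0)
wt-appendRow {zero}  M v j = +-identityʳ _
wt-appendRow {suc r} M v j = begin
  top + wt (column (appendRow (M ∘ suc) v) j)  ≡⟨ cong (top +_) (wt-appendRow (M ∘ suc) v j) ⟩
  top + (wt (column (M ∘ suc) j) + new)         ≡⟨ sym (+-assoc top _ new) ⟩
  wt (column M j) + new                         ∎
  where
  top new : ℕ
  top = if M zero j then 1 else 0
  new = if v j then 1 else 0

wt-false : ∀ n → wt {n} (λ _ → false) ≡ 0
wt-false zero    = refl
wt-false (suc n) = wt-false n

split-n : ∀ x n .{{_ : NonZero n}} → x + n ≡ x + 1 + (n ∸ 1)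
split-n x (suc n) = sym (+-assoc x 1 n)

mod-succ⇔ : ∀ {n} .{{_ : NonZero n}} k l → ((k + 1) % n ≡ (l + 1) % n) ⇔ (k % n ≡ l % n)
mod-succ⇔ {n} k l = mk⇔ cancel shift
  where
  back : ∀ x → x % n ≡ ((x + 1) % n + (n ∸ 1) % n) % n
  back x = begin
    x % n                         ≡⟨ sym ([m+n]%n≡m%n x n) ⟩
    (x + n) % n                   ≡⟨ cong (_% n) (split-n x n) ⟩
    (x + 1 + (n ∸ 1)) % n         ≡⟨ %-distribˡ-+ (x + 1) (n ∸ 1) n ⟩
    ((x + 1) % n + (n ∸ 1) % n) % n ∎
  cancel : (k + 1) % n ≡ (l + 1) % n → k % n ≡ l % n
  cancel e = trans (back k) (trans (cong (λ t → (t + (n ∸ 1) % n) % n) e) (sym (back l)))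
  shift : k % n ≡ l % n → (k + 1) % n ≡ (l + 1) % n
  shift e = trans (%-distribˡ-+ k 1 n)
                  (trans (cong (λ t → (t + 1 % n) % n) e) (sym (%-distribˡ-+ l 1 n)))

residue-shift : ∀ {n} .{{_ : NonZero n}} k l → l < n →
  ((k + 1) % n ≡ᵇ (l + 1) % n) ≡ (k % n ≡ᵇ l)
residue-shift {n} k l l<n =
  trans (does-⇔ (mod-succ⇔ k l) (_ ≟ _) (_ ≟ _)) (cong (k % n ≡ᵇ_) (m<n⇒m%n≡m l<n))

liftedRow-suc : ∀ {r c} (M : Mat r c) {i₁ i₂} → i₁ < 4 → i₂ < 4 → ∀ j →
  weightRow (appendRow (prependZeroCol M) allOne) ((i₁ + 1) % 4) ((i₂ + 1) % 4) (suc j)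
    ≡ weightRow M i₁ i₂ j
liftedRow-suc M {i₁} {i₂} i₁<4 i₂<4 j = begin
  test (wt (column (appendRow (prependZeroCol M) allOne) (suc j)))
    ≡⟨ cong test (wt-appendRow (prependZeroCol M) allOne (suc j)) ⟩
  test (k + 1)
    ≡⟨ cong₂ _∨_ (residue-shift k i₁ i₁<4) (residue-shift k i₂ i₂<4) ⟩
  weightRow M i₁ i₂ j ∎
  where
  k : ℕ
  k = wt (column M j)
  test : ℕ → Bool
  test x = (x % 4 ≡ᵇ (i₁ + 1) % 4) ∨ (x % 4 ≡ᵇ (i₂ + 1) % 4)

liftedRow-zero : ∀ {r c} (M : Mat r c) {i₁ i₂} → i₁ < 4 → i₂ < 4 →
  weightRow (appendRow (prependZeroCol M) allOne) ((i₁ + 1) % 4) ((i₂ + 1) % 4) zero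
    ≡ (0 ≡ᵇ i₁) ∨ (0 ≡ᵇ i₂)
liftedRow-zero {r} M {i₁} {i₂} i₁<4 i₂<4 = begin
  test (wt (column (appendRow (prependZeroCol M) allOne) zero))
    ≡⟨ cong test (trans (wt-appendRow (prependZeroCol M) allOne zero)
                        (cong (_+ 1) (wt-false r))) ⟩
  test 1
    ≡⟨ cong₂ _∨_ (residue-shift 0 i₁ i₁<4) (residue-shift 0 i₂ i₂<4) ⟩
  (0 ≡ᵇ i₁) ∨ (0 ≡ᵇ i₂) ∎
  where
  test : ℕ → Bool
  test x = (x % 4 ≡ᵇ (i₁ + 1) % 4) ∨ (x % 4 ≡ᵇ (i₂ + 1) % 4)

lemma2p5 : (m : ℕ) → 4 ≤ m → m % 2 ≡ 0 →
    (h : Fin (2 ^ m ∸ 1) → Vec Bool m) → IsHammingEnum h →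
    (i₁ i₂ : ℕ) → i₁ < 4 → i₂ < 4 → (i₁ + i₂) % 2 ≡ 1 →
    (extend (Cij h i₁ i₂) ≐ CstarJ h ((i₁ + 1) % 4) ((i₂ + 1) % 4))
      ⇔ (i₁ ≢ 0 × i₂ ≢ 0)
lemma2p5 (suc (suc k)) _ _ h hamming i₁ i₂ i₁<4 i₂<4 _ =
  ⇔-trans (criterion (hamming-oddCodeword h hamming))
  (⇔-trans (≡false-cong (liftedRow-zero (Hmat h) i₁<4 i₂<4))
  (⇔-trans (∨-false⇔ (0 ≡ᵇ i₁) (0 ≡ᵇ i₂))
           (zero-test⇔ i₁ ×-⇔ zero-test⇔ i₂)))
  where
  open ExtensionCriterion (Hmat h) (weightRow (Hmat h) i₁ i₂)
         (weightRow (Hstar h) ((i₁ + 1) % 4) ((i₂ + 1) % 4))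
         (liftedRow-suc (Hmat h) i₁<4 i₂<4)
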